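{- $(\{P \mid \mathbf{CRF}(P)=P\}, \sqcap, \mathit{false}, \mathbin{;}, \mathrm{II}_c, \star)$ forms a weak Kleene algebra.
   Context: Reactive relations are fixed points of $\mathbf{RR}(P) \triangleq \exists (ok, ok', wait, wait') \bullet \mathbf{R1}(\mathbf{R2}(P))$, where $\mathbf{R1}(P) \triangleq P \land tr \le tr'$ and $\mathbf{R2}(P) \triangleq P[\langle\rangle, tr'-tr/tr, tr'] \triangleleft tr \le tr' \triangleright P$. Stateful-failure reactive finalisers are fixed points of $\mathbf{CRF}(P) \triangleq \exists (ref, ref') \bullet \mathbf{RR}(P)$ (no reference to the refusal variables). The identity is $\mathrm{II}_c \triangleq (st' = st \land tr' = tr)$. Nondeterministic choice $\sqcap$ is disjunction, $\mathbin{;}$ is relational composition, and the star is $P^{\star} \triangleq \mathrm{II}_c \sqcap \bigvee_{i\in\mathbb{N}} P^{i+1}$. A weak Kleene algebra $(K,+,0,\cdot,1,\star)$ is one where $(K,+,0)$ is an idempotent commutative monoid, $(K,\cdot,1)$ is a monoid, $\cdot$ distributes over $+$ on both sides, $0$ is a left annihilator, and (with $x\le y \iff x+y=y$) $1 + x\cdot x^\star \le x^\star$, $z + x\cdot y \le y \implies x^\star\cdot z \le y$, $z + y\cdot x \le y \implies z\cdot x^\star \le y$. -}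

module Defs where

open import Level using (Level; Lift; _⊔_) renaming (suc to lsuc; zero to lzero)
open import Data.Bool using (Bool)
open import Data.Nat using (ℕ; zero; suc)
open import Data.List using (List; []; _++_)
open import Data.Empty using (⊥)
open import Data.Product using (Σ; _×_)
open import Data.Sum using (_⊎_)
open import Relation.Nullary using (¬_)
open import Relation.Binary.PropositionalEquality using (_≡_)

-- Weak Kleene algebra on a subset H of a carrier A (with setoid
-- equality _≈_), as defined in the paper.  "The subset forms a weak
-- Kleene algebra" = H contains 0,1 and is closed under +, ·, ⋆, and all
-- axioms hold for elements of H.  Since equality is a setoid equality,
-- we also require it to be an equivalence and the operations congruent.

record IsWeakKleeneAlgebraOn {a h ℓ : Level} {A : Set a}
  (H : A → Set h) (_≈_ : A → A → Set ℓ)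
  (_+_ : A → A → A) (0# : A) (_·_ : A → A → A) (1# : A) (_⋆ : A → A)
  : Set (a ⊔ h ⊔ ℓ) where
  infix 4 _≤_
  _≤_ : A → A → Set ℓ
  x ≤ y = (x + y) ≈ y
  field
    H-0 : H 0#
    H-1 : H 1#
    H-+ : ∀ {x y} → H x → H y → H (x + y)
    H-· : ∀ {x y} → H x → H y → H (x · y)
    H-⋆ : ∀ {x} → H x → H (x ⋆)
    ≈-refl  : ∀ {x} → H x → x ≈ x
    ≈-sym   : ∀ {x y} → H x → H y → x ≈ y → y ≈ x
    ≈-trans : ∀ {x y z} → H x → H y → H z → x ≈ y → y ≈ z → x ≈ z
    +-cong  : ∀ {x y u v} → H x → H y → H u → H v → x ≈ y → u ≈ v → (x + u) ≈ (y + v)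
    ·-cong  : ∀ {x y u v} → H x → H y → H u → H v → x ≈ y → u ≈ v → (x · u) ≈ (y · v)
    ⋆-cong  : ∀ {x y} → H x → H y → x ≈ y → (x ⋆) ≈ (y ⋆)
    +-assoc     : ∀ {x y z} → H x → H y → H z → ((x + y) + z) ≈ (x + (y + z))
    +-comm      : ∀ {x y} → H x → H y → (x + y) ≈ (y + x)
    +-idem      : ∀ {x} → H x → (x + x) ≈ x
    +-identityˡ : ∀ {x} → H x → (0# + x) ≈ x
    +-identityʳ : ∀ {x} → H x → (x + 0#) ≈ x
    ·-assoc     : ∀ {x y z} → H x → H y → H z → ((x · y) · z) ≈ (x · (y · z))
    ·-identityˡ : ∀ {x} → H x → (1# · x) ≈ x
    ·-identityʳ : ∀ {x} → H x → (x · 1#) ≈ x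
    distribˡ : ∀ {x y z} → H x → H y → H z → (x · (y + z)) ≈ ((x · y) + (x · z))
    distribʳ : ∀ {x y z} → H x → H y → H z → ((y + z) · x) ≈ ((y · x) + (z · x))
    annihilˡ : ∀ {x} → H x → (0# · x) ≈ 0#
    star-unfold  : ∀ {x} → H x → (1# + (x · (x ⋆))) ≤ (x ⋆)
    star-inductˡ : ∀ {x y z} → H x → H y → H z → (z + (x · y)) ≤ y → ((x ⋆) · z) ≤ y
    star-inductʳ : ∀ {x y z} → H x → H y → H z → (z + (y · x)) ≤ y → (z · (x ⋆)) ≤ y

module Reactive (E S : Set) where

  record Obs : Set₁ where
    field
      ok   : Bool
      wait : Bool
      tr   : List E
      st   : S
      ref  : E → Set          -- refusal set ⊆ E
  open Obs public

  -- alphabetised relations: predicates on (before, after)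
  Rel : Set₂
  Rel = Obs → Obs → Set₁

  infix 4 _≐_
  _≐_ : Rel → Rel → Set₁
  P ≐ Q = ∀ a b → (P a b → Q a b) × (Q a b → P a b)

  _≼_ : List E → List E → Set
  xs ≼ ys = Σ (List E) λ s → ys ≡ xs ++ s

  R1 : Rel → Rel
  R1 P a b = P a b × (tr a ≼ tr b)

  -- R2(P) = P[⟨⟩, tr'-tr / tr, tr'] ◁ tr ≤ tr' ▷ P ;
  -- the witness s with tr' = tr ++ s is (uniquely) tr' - tr.
  R2 : Rel → Rel
  R2 P a b =
    (Σ (List E) λ s → (tr b ≡ tr a ++ s)
                     × P (record a { tr = [] }) (record b { tr = s }))
    ⊎ ((¬ (tr a ≼ tr b)) × P a b)

  RR : Rel → Rel
  RR P a b = Σ Bool λ o → Σ Bool λ o' → Σ Bool λ w → Σ Bool λ w' →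
    R1 (R2 P) (record a { ok = o ; wait = w }) (record b { ok = o' ; wait = w' })

  CRF : Rel → Rel
  CRF P a b = Σ (E → Set) λ r → Σ (E → Set) λ r' →
    RR P (record a { ref = r }) (record b { ref = r' })

  CRF-healthy : Rel → Set₁
  CRF-healthy P = CRF P ≐ P

  _⊓_ : Rel → Rel → Rel
  (P ⊓ Q) a b = P a b ⊎ Q a b

  false : Rel
  false _ _ = Lift (lsuc lzero) ⊥

  _⨾_ : Rel → Rel → Rel
  (P ⨾ Q) a b = Σ Obs λ m → P a m × Q m b

  IIc : Rel
  IIc a b = Lift (lsuc lzero) ((st b ≡ st a) × (tr b ≡ tr a))

  -- pow P i = P^(i+1)
  pow : Rel → ℕ → Rel
  pow P zero    = P
  pow P (suc i) = P ⨾ pow P i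

  _⋆ : Rel → Rel
  (P ⋆) = IIc ⊓ (λ a b → Σ ℕ λ i → pow P i a b)

-- ⊓, false and ⨾ are union, the empty relation and relational composition,
-- and P ⋆ = IIc ⊓ ⋃ᵢ Pⁱ⁺¹, so every weak Kleene algebra law holds for
-- arbitrary relations as long as IIc is a left and right unit of ⨾ on the
-- relations involved.  That is where healthiness enters: a CRF-healthy
-- relation relates a to b only through st a, st b and the extension s with
-- tr b = tr a ++ s (CRF-elim, CRF-intro), so it can be re-based onto any
-- trace prefix (retrace).  This makes IIc a unit and shows that ⨾, hence ⋆,
-- preserves healthiness; unions do because CRF commutes with them.
module Submission where

open import Defs
open import Level using (lift)
open import Data.Bool using (Bool)
open import Data.Nat using (ℕ; zero; suc)
open import Data.List using (List; []; _++_)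
open import Data.List.Properties using (++-assoc; ++-identityʳ; ++-cancelˡ)
open import Data.Empty using (⊥-elim)
open import Data.Product using (Σ; ∃; _×_; _,_; proj₁; proj₂)
open import Data.Sum using (inj₁; inj₂; [_,_]′; swap; reduce; assocʳ; assocˡ)
import Data.Sum as Sum
open import Function using (_∘_; id)
open import Relation.Binary.PropositionalEquality
  using (_≡_; refl; sym; trans; cong; subst₂)

module CRF-WeakKleeneAlgebra (E S : Set) where
  open Reactive E S

  private variable
    P P′ Q Q′ R : Rel
    F : ℕ → Rel
    a a′ b b′ : Obs
    s : List E

  infix 4 _⊆_ _≤_

  _⊆_ : Rel → Rel → Set₁
  P ⊆ Q = ∀ a b → P a b → Q a b

  _≤_ : Rel → Rel → Set₁
  P ≤ Q = (P ⊓ Q) ≐ Q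

  ⋃ : (ℕ → Rel) → Rel
  ⋃ F a b = Σ ℕ λ i → F i a b

  ⊆-refl : P ⊆ P
  ⊆-refl _ _ = id

  ⊆-trans : P ⊆ Q → Q ⊆ R → P ⊆ R
  ⊆-trans P⊆Q Q⊆R a b = Q⊆R a b ∘ P⊆Q a b

  ⊆-antisym : P ⊆ Q → Q ⊆ P → P ≐ Q
  ⊆-antisym P⊆Q Q⊆P a b = P⊆Q a b , Q⊆P a b

  ≐⇒⊆ : P ≐ Q → P ⊆ Q
  ≐⇒⊆ P≐Q a b = proj₁ (P≐Q a b)

  ≐⇒⊇ : P ≐ Q → Q ⊆ P
  ≐⇒⊇ P≐Q a b = proj₂ (P≐Q a b)

  ≐-refl : P ≐ P
  ≐-refl = ⊆-antisym ⊆-refl ⊆-refl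

  ≐-sym : P ≐ Q → Q ≐ P
  ≐-sym P≐Q = ⊆-antisym (≐⇒⊇ P≐Q) (≐⇒⊆ P≐Q)

  ≐-trans : P ≐ Q → Q ≐ R → P ≐ R
  ≐-trans P≐Q Q≐R = ⊆-antisym (⊆-trans (≐⇒⊆ P≐Q) (≐⇒⊆ Q≐R)) (⊆-trans (≐⇒⊇ Q≐R) (≐⇒⊇ P≐Q))

  ⊆⇒≤ : P ⊆ Q → P ≤ Q
  ⊆⇒≤ P⊆Q = ⊆-antisym (λ a b → [ P⊆Q a b , id ]′) (λ _ _ → inj₂)

  ≤⇒⊆ : P ≤ Q → P ⊆ Q
  ≤⇒⊆ P≤Q a b = ≐⇒⊆ P≤Q a b ∘ inj₁

  ⊓-mono : P ⊆ P′ → Q ⊆ Q′ → (P ⊓ Q) ⊆ (P′ ⊓ Q′)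
  ⊓-mono P⊆P′ Q⊆Q′ a b = Sum.map (P⊆P′ a b) (Q⊆Q′ a b)

  ⨾-mono : P ⊆ P′ → Q ⊆ Q′ → (P ⨾ Q) ⊆ (P′ ⨾ Q′)
  ⨾-mono P⊆P′ Q⊆Q′ a b (m , p , q) = m , P⊆P′ a m p , Q⊆Q′ m b q

  pow-mono : P ⊆ Q → ∀ i → pow P i ⊆ pow Q i
  pow-mono P⊆Q zero    = P⊆Q
  pow-mono P⊆Q (suc i) = ⨾-mono P⊆Q (pow-mono P⊆Q i)

  ⋆-mono : P ⊆ Q → (P ⋆) ⊆ (Q ⋆)
  ⋆-mono P⊆Q a b = Sum.map₂ λ (i , pⁱ) → i , pow-mono P⊆Q i a b pⁱ

  ⊓-cong : P ≐ P′ → Q ≐ Q′ → (P ⊓ Q) ≐ (P′ ⊓ Q′)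
  ⊓-cong P≐P′ Q≐Q′ =
    ⊆-antisym (⊓-mono (≐⇒⊆ P≐P′) (≐⇒⊆ Q≐Q′)) (⊓-mono (≐⇒⊇ P≐P′) (≐⇒⊇ Q≐Q′))

  ⨾-cong : P ≐ P′ → Q ≐ Q′ → (P ⨾ Q) ≐ (P′ ⨾ Q′)
  ⨾-cong P≐P′ Q≐Q′ =
    ⊆-antisym (⨾-mono (≐⇒⊆ P≐P′) (≐⇒⊆ Q≐Q′)) (⨾-mono (≐⇒⊇ P≐P′) (≐⇒⊇ Q≐Q′))

  ⋆-cong : P ≐ Q → (P ⋆) ≐ (Q ⋆)
  ⋆-cong P≐Q = ⊆-antisym (⋆-mono (≐⇒⊆ P≐Q)) (⋆-mono (≐⇒⊇ P≐Q))

  ⊓-assoc : ((P ⊓ Q) ⊓ R) ≐ (P ⊓ (Q ⊓ R))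
  ⊓-assoc = ⊆-antisym (λ _ _ → assocʳ) (λ _ _ → assocˡ)

  ⊓-comm : (P ⊓ Q) ≐ (Q ⊓ P)
  ⊓-comm = ⊆-antisym (λ _ _ → swap) (λ _ _ → swap)

  ⊓-idem : (P ⊓ P) ≐ P
  ⊓-idem = ⊆-antisym (λ _ _ → reduce) (λ _ _ → inj₁)

  ⊓-identityˡ : (false ⊓ P) ≐ P
  ⊓-identityˡ = ⊆-antisym (λ _ _ → [ (λ ()) , id ]′) (λ _ _ → inj₂)

  ⊓-identityʳ : (P ⊓ false) ≐ P
  ⊓-identityʳ = ⊆-antisym (λ _ _ → [ id , (λ ()) ]′) (λ _ _ → inj₁)

  ⨾-assoc : ((P ⨾ Q) ⨾ R) ≐ (P ⨾ (Q ⨾ R))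
  ⨾-assoc = ⊆-antisym (λ _ _ (m , (n , p , q) , r) → n , p , m , q , r)
                      (λ _ _ (n , p , m , q , r) → m , (n , p , q) , r)

  ⨾-distribˡ-⊓ : (P ⨾ (Q ⊓ R)) ≐ ((P ⨾ Q) ⊓ (P ⨾ R))
  ⨾-distribˡ-⊓ =
    ⊆-antisym (λ _ _ (m , p , qr) → Sum.map (λ q → m , p , q) (λ r → m , p , r) qr)
              (λ { _ _ (inj₁ (m , p , q)) → m , p , inj₁ q ; _ _ (inj₂ (m , p , r)) → m , p , inj₂ r })

  ⨾-distribʳ-⊓ : ((Q ⊓ R) ⨾ P) ≐ ((Q ⨾ P) ⊓ (R ⨾ P))
  ⨾-distribʳ-⊓ =
    ⊆-antisym (λ _ _ (m , qr , p) → Sum.map (λ q → m , q , p) (λ r → m , r , p) qr)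
              (λ { _ _ (inj₁ (m , q , p)) → m , inj₁ q , p ; _ _ (inj₂ (m , r , p)) → m , inj₂ r , p })

  ⨾-zeroˡ : (false ⨾ P) ≐ false
  ⨾-zeroˡ = ⊆-antisym (λ { _ _ (_ , lift () , _) }) (λ _ _ ())

  pow-⨾-⊆ : (P ⨾ Q) ⊆ Q → ∀ i → (pow P i ⨾ Q) ⊆ Q
  pow-⨾-⊆ PQ⊆Q zero = PQ⊆Q
  pow-⨾-⊆ PQ⊆Q (suc i) a b (m , (n , p , pⁱ) , q) =
    PQ⊆Q a b (n , p , pow-⨾-⊆ PQ⊆Q i n b (m , pⁱ , q))

  ⨾-pow-⊆ : (Q ⨾ P) ⊆ Q → ∀ i → (Q ⨾ pow P i) ⊆ Q
  ⨾-pow-⊆ QP⊆Q zero = QP⊆Q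
  ⨾-pow-⊆ QP⊆Q (suc i) a b (m , q , (n , p , pⁱ)) =
    ⨾-pow-⊆ QP⊆Q i a b (n , QP⊆Q a n (m , q , p) , pⁱ)

  ⋆-unfold : (P ⨾ IIc) ⊆ P → (IIc ⊓ (P ⨾ (P ⋆))) ⊆ (P ⋆)
  ⋆-unfold _      _ _ (inj₁ skip)                     = inj₁ skip
  ⋆-unfold P⨾II⊆P a b (inj₂ (m , p , inj₁ skip))      = inj₂ (zero , P⨾II⊆P a b (m , p , skip))
  ⋆-unfold _      _ _ (inj₂ (m , p , inj₂ (i , pⁱ))) = inj₂ (suc i , m , p , pⁱ)

  ⋆-inductˡ : (IIc ⨾ R) ⊆ R → (R ⊓ (P ⨾ Q)) ⊆ Q → ((P ⋆) ⨾ R) ⊆ Q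
  ⋆-inductˡ II⨾R⊆R R⊓PQ⊆Q a b (m , inj₁ skip , r) =
    R⊓PQ⊆Q a b (inj₁ (II⨾R⊆R a b (m , skip , r)))
  ⋆-inductˡ _ R⊓PQ⊆Q a b (m , inj₂ (i , pⁱ) , r) =
    pow-⨾-⊆ (λ a b → R⊓PQ⊆Q a b ∘ inj₂) i a b (m , pⁱ , R⊓PQ⊆Q m b (inj₁ r))

  ⋆-inductʳ : (R ⨾ IIc) ⊆ R → (R ⊓ (Q ⨾ P)) ⊆ Q → (R ⨾ (P ⋆)) ⊆ Q
  ⋆-inductʳ R⨾II⊆R R⊓QP⊆Q a b (m , r , inj₁ skip) =
    R⊓QP⊆Q a b (inj₁ (R⨾II⊆R a b (m , r , skip)))
  ⋆-inductʳ _ R⊓QP⊆Q a b (m , r , inj₂ (i , pⁱ)) =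
    ⨾-pow-⊆ (λ a b → R⊓QP⊆Q a b ∘ inj₂) i a b (m , R⊓QP⊆Q a m (inj₁ r) , pⁱ)

  Unobserved : Set₁
  Unobserved = Bool × Bool × (E → Set)

  unobserved : Obs → Unobserved
  unobserved a = ok a , wait a , ref a

  obs : Unobserved → List E → S → Obs
  obs (o , w , r) t σ = record { ok = o ; wait = w ; tr = t ; st = σ ; ref = r }

  Run : Rel → S → List E → S → Set₁
  Run P σ s σ′ = Σ Unobserved λ u → Σ Unobserved λ u′ → P (obs u [] σ) (obs u′ s σ′)

  Extension : Rel → Rel
  Extension P a b = ∃ λ s → tr b ≡ tr a ++ s × Run P (st a) s (st b)

  CRF-elim : ∀ P → CRF P ⊆ Extension P
  CRF-elim _ _ _ (r , r′ , o , o′ , w , w′ , inj₁ (s , tr≡ , p) , _) =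
    s , tr≡ , (o , w , r) , (o′ , w′ , r′) , p
  CRF-elim _ _ _ (_ , _ , _ , _ , _ , _ , inj₂ (tr⋠ , _) , tr≼) = ⊥-elim (tr⋠ tr≼)

  CRF-intro : ∀ P → Extension P ⊆ CRF P
  CRF-intro _ _ _ (s , tr≡ , (o , w , r) , (o′ , w′ , r′) , p) =
    r , r′ , o , o′ , w , w′ , inj₁ (s , tr≡ , p) , (s , tr≡)

  CRF-mono : P ⊆ Q → CRF P ⊆ CRF Q
  CRF-mono {P} {Q} P⊆Q a b c with CRF-elim P a b c
  ... | s , tr≡ , u , u′ , p = CRF-intro Q a b (s , tr≡ , u , u′ , P⊆Q _ _ p)

  CRF-⊓ : CRF (P ⊓ Q) ⊆ (CRF P ⊓ CRF Q)
  CRF-⊓ {P} {Q} a b c with CRF-elim (P ⊓ Q) a b c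
  ... | s , tr≡ , u , u′ , inj₁ p = inj₁ (CRF-intro P a b (s , tr≡ , u , u′ , p))
  ... | s , tr≡ , u , u′ , inj₂ q = inj₂ (CRF-intro Q a b (s , tr≡ , u , u′ , q))

  CRF-⋃ : CRF (⋃ F) ⊆ ⋃ (CRF ∘ F)
  CRF-⋃ {F} a b c with CRF-elim (⋃ F) a b c
  ... | s , tr≡ , u , u′ , (i , p) = i , CRF-intro (F i) a b (s , tr≡ , u , u′ , p)

  healthy-≼ : CRF-healthy P → P a b → tr a ≼ tr b
  healthy-≼ {P} {a} {b} hP p with CRF-elim P a b (≐⇒⊇ hP a b p)
  ... | s , tr≡ , _ = s , tr≡

  retrace : CRF-healthy P → P a b → tr b ≡ tr a ++ s → tr b′ ≡ tr a′ ++ s →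
            st a′ ≡ st a → st b′ ≡ st b → P a′ b′
  retrace {P} {a} {b} {s} {b′} {a′} hP p tr≡ tr′≡ st≡ st′≡ with CRF-elim P a b (≐⇒⊇ hP a b p)
  ... | s₀ , tr≡₀ , run with ++-cancelˡ (tr a) s₀ s (trans (sym tr≡₀) tr≡)
  ... | refl = ≐⇒⊆ hP a′ b′
                 (CRF-intro P a′ b′ (s , tr′≡ , subst₂ (λ σ σ′ → Run P σ s σ′) (sym st≡) (sym st′≡) run))

  IIc-⨾ : CRF-healthy P → (IIc ⨾ P) ⊆ P
  IIc-⨾ hP a b (m , lift (st≡ , tr≡) , p) with healthy-≼ hP p
  ... | s , trₘ≡ = retrace hP p trₘ≡ (trans trₘ≡ (cong (_++ s) tr≡)) (sym st≡) refl

  ⨾-IIc : CRF-healthy P → (P ⨾ IIc) ⊆ P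
  ⨾-IIc hP a b (m , p , lift (st≡ , tr≡)) with healthy-≼ hP p
  ... | _ , trₘ≡ = retrace hP p trₘ≡ (trans tr≡ trₘ≡) refl st≡

  false-healthy : CRF-healthy false
  false-healthy = ⊆-antisym CRF-false⊆ λ _ _ ()
    where
    CRF-false⊆ : CRF false ⊆ false
    CRF-false⊆ a b c with CRF-elim false a b c
    ... | _ , _ , _ , _ , lift ()

  IIc-healthy : CRF-healthy IIc
  IIc-healthy = ⊆-antisym CRF-IIc⊆ IIc⊆CRF
    where
    CRF-IIc⊆ : CRF IIc ⊆ IIc
    CRF-IIc⊆ a b c with CRF-elim IIc a b c
    ... | _ , tr≡ , _ , _ , lift (st≡ , refl) = lift (st≡ , trans tr≡ (++-identityʳ (tr a)))
    IIc⊆CRF : IIc ⊆ CRF IIc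
    IIc⊆CRF a b (lift (st≡ , tr≡)) =
      CRF-intro IIc a b
        ([] , trans tr≡ (sym (++-identityʳ (tr a))) , unobserved a , unobserved b , lift (st≡ , refl))

  ⊓-healthy : CRF-healthy P → CRF-healthy Q → CRF-healthy (P ⊓ Q)
  ⊓-healthy {P} {Q} hP hQ =
    ⊆-antisym (⊆-trans CRF-⊓ (⊓-mono (≐⇒⊆ hP) (≐⇒⊆ hQ)))
              (λ a b → [ CRF-mono {Q = P ⊓ Q} (λ _ _ → inj₁) a b ∘ ≐⇒⊇ hP a b
                       , CRF-mono {Q = P ⊓ Q} (λ _ _ → inj₂) a b ∘ ≐⇒⊇ hQ a b ]′)

  ⋃-healthy : (∀ i → CRF-healthy (F i)) → CRF-healthy (⋃ F)
  ⋃-healthy {F} hF =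
    ⊆-antisym (λ a b c → let i , cᵢ = CRF-⋃ {F} a b c in i , ≐⇒⊆ (hF i) a b cᵢ)
              (λ a b (i , p) → CRF-mono {Q = ⋃ F} (λ _ _ → i ,_) a b (≐⇒⊇ (hF i) a b p))

  ⨾-healthy : CRF-healthy P → CRF-healthy Q → CRF-healthy (P ⨾ Q)
  ⨾-healthy {P} {Q} hP hQ = ⊆-antisym CRF-⨾⊆ ⨾⊆CRF
    where
    CRF-⨾⊆ : CRF (P ⨾ Q) ⊆ (P ⨾ Q)
    CRF-⨾⊆ a b c with CRF-elim (P ⨾ Q) a b c
    ... | s , tr≡ , _ , _ , m , p , q with healthy-≼ hQ q
    ... | s₂ , s≡ =
      record m { tr = tr a ++ tr m } ,
      retrace hP p refl refl refl refl ,
      retrace hQ q s≡ (trans tr≡ (trans (cong (tr a ++_) s≡) (sym (++-assoc (tr a) (tr m) s₂))))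
              refl refl
    ⨾⊆CRF : (P ⨾ Q) ⊆ CRF (P ⨾ Q)
    ⨾⊆CRF a b (m , p , q) with healthy-≼ hP p | healthy-≼ hQ q
    ... | s₁ , trₘ≡ | s₂ , tr≡ =
      CRF-intro (P ⨾ Q) a b
        ( s₁ ++ s₂ , trans tr≡ (trans (cong (_++ s₂) trₘ≡) (++-assoc (tr a) s₁ s₂))
        , unobserved a , unobserved b , record m { tr = s₁ }
        , retrace hP p trₘ≡ refl refl refl , retrace hQ q tr≡ refl refl refl)

  pow-healthy : CRF-healthy P → ∀ i → CRF-healthy (pow P i)
  pow-healthy hP zero    = hP
  pow-healthy hP (suc i) = ⨾-healthy hP (pow-healthy hP i)

  ⋆-healthy : CRF-healthy P → CRF-healthy (P ⋆)
  ⋆-healthy hP = ⊓-healthy IIc-healthy (⋃-healthy (pow-healthy hP))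

  isWeakKleeneAlgebra : IsWeakKleeneAlgebraOn CRF-healthy _≐_ _⊓_ false _⨾_ IIc _⋆
  isWeakKleeneAlgebra = record
    { H-0          = false-healthy
    ; H-1          = IIc-healthy
    ; H-+          = ⊓-healthy
    ; H-·          = ⨾-healthy
    ; H-⋆          = ⋆-healthy
    ; ≈-refl       = λ _ → ≐-refl
    ; ≈-sym        = λ _ _ → ≐-sym
    ; ≈-trans      = λ _ _ _ → ≐-trans
    ; +-cong       = λ _ _ _ _ → ⊓-cong
    ; ·-cong       = λ _ _ _ _ → ⨾-cong
    ; ⋆-cong       = λ _ _ → ⋆-cong
    ; +-assoc      = λ _ _ _ → ⊓-assoc
    ; +-comm       = λ _ _ → ⊓-comm
    ; +-idem       = λ _ → ⊓-idem
    ; +-identityˡ  = λ _ → ⊓-identityˡ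
    ; +-identityʳ  = λ _ → ⊓-identityʳ
    ; ·-assoc      = λ _ _ _ → ⨾-assoc
    ; ·-identityˡ  = λ hx → ⊆-antisym (IIc-⨾ hx) (λ a _ p → a , lift (refl , refl) , p)
    ; ·-identityʳ  = λ hx → ⊆-antisym (⨾-IIc hx) (λ _ b p → b , p , lift (refl , refl))
    ; distribˡ     = λ _ _ _ → ⨾-distribˡ-⊓
    ; distribʳ     = λ _ _ _ → ⨾-distribʳ-⊓
    ; annihilˡ     = λ _ → ⨾-zeroˡ
    ; star-unfold  = λ hx → ⊆⇒≤ (⋆-unfold (⨾-IIc hx))
    ; star-inductˡ = λ _ _ hz y≥ → ⊆⇒≤ (⋆-inductˡ (IIc-⨾ hz) (≤⇒⊆ y≥))
    ; star-inductʳ = λ _ _ hz y≥ → ⊆⇒≤ (⋆-inductʳ (⨾-IIc hz) (≤⇒⊆ y≥))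
    }

theorem13 : (E S : Set) → let open Reactive E S in
    IsWeakKleeneAlgebraOn CRF-healthy _≐_ _⊓_ false _⨾_ IIc _⋆
theorem13 E S = CRF-WeakKleeneAlgebra.isWeakKleeneAlgebra E S
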